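{- Let $n\ge1$, $x=(x_0,\dots,x_{n-1})\in\mathbb{F}_p{}^n$ and $y\in\mathbb{F}_p$. When $p=2$, a minimal polynomial expression of $\operatorname{ismax}(y;x)$ is \[ \operatorname{ismax}(y;x)=y+\prod_{i=0}^{n-1}(1+x_i). \] When $p=3$, a minimal polynomial expression of $\operatorname{ismax}(y;x)$ is \[ \operatorname{ismax}(y;x)=-y^2+y\Bigl(\prod_{i=0}^{n-1}(1+x_i)^2+\prod_{i=0}^{n-1}(1-x_i^2)+1\Bigr)+\prod_{i=0}^{n-1}(1-x_i^2). \]
   Context: $\mathbb{F}_p$ is identified with $\{0,1,\dots,p-1\}$ with the usual ordering; $\max(x)$ is the largest of $x_0,\dots,x_{n-1}$, and $\operatorname{ismax}(y;x)$ equals $1$ if $\max(x)=y$ and $0$ otherwise. A minimal polynomial expression is a polynomial over $\mathbb{F}_p$ of degree at most $p-1$ in each variable coinciding with the function on all inputs. -}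

module Defs where

open import Data.Nat as ℕ using (ℕ; zero; suc; _⊔_; _≤_)
open import Data.Fin using (Fin; zero; suc; toℕ)
open import Data.Fin.Properties using () renaming (_≟_ to _≟ᶠ_)
open import Data.Integer as ℤ using (ℤ; +_; _+_; _*_; -_; _-_)
open import Data.Integer.Divisibility using (_∣_)
open import Relation.Nullary using (yes; no)
open import Data.Product using (_×_)

-- Elements of 𝔽_p are identified with {0,…,p-1}, i.e. with Fin p (usual order via toℕ).
-- Field arithmetic in 𝔽_p is integer arithmetic modulo p; equality in 𝔽_p is
-- congruence modulo p.
_≡[mod_]_ : ℤ → ℕ → ℤ → Set
a ≡[mod p ] b = (+ p) ∣ (a - b)

maxℕ : ∀ {p} m → (Fin (suc m) → Fin p) → ℕ
maxℕ zero    x = toℕ (x zero)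
maxℕ (suc m) x = toℕ (x zero) ⊔ maxℕ m (λ i → x (suc i))

ismax : ∀ {p} m → Fin p → (Fin (suc m) → Fin p) → ℤ
ismax m y x with toℕ y ℕ.≟ maxℕ m x
... | yes _ = + 1
... | no  _ = + 0

-- Polynomial expressions with integer coefficients (reduced mod p when evaluated)
-- in the variables indexed by V.
data Poly (V : Set) : Set where
  var : V → Poly V
  con : ℤ → Poly V
  _⊕_ : Poly V → Poly V → Poly V
  _⊗_ : Poly V → Poly V → Poly V
  ⊝_  : Poly V → Poly V

infixl 6 _⊕_
infixl 7 _⊗_
infix  8 ⊝_

eval : ∀ {V} → (V → ℤ) → Poly V → ℤ
eval ρ (var v) = ρ v
eval ρ (con c) = c
eval ρ (a ⊕ b) = eval ρ a + eval ρ b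
eval ρ (a ⊗ b) = eval ρ a * eval ρ b
eval ρ (⊝ a)   = - eval ρ a

-- Syntactic (upper bound for the) degree in variable v of a polynomial expression;
-- the true degree of the expanded polynomial is at most this number.
degIn : ∀ {k} → Fin k → Poly (Fin k) → ℕ
degIn v (var w) with v ≟ᶠ w
... | yes _ = 1
... | no  _ = 0
degIn v (con c) = 0
degIn v (a ⊕ b) = degIn v a ⊔ degIn v b
degIn v (a ⊗ b) = degIn v a ℕ.+ degIn v b
degIn v (⊝ a)   = degIn v a

∏ : ∀ {V} n → (Fin n → Poly V) → Poly V
∏ zero    f = con (+ 1)
∏ (suc n) f = f zero ⊗ ∏ n (λ i → f (suc i))

-- Variables for ismax(y; x_0,…,x_{n-1}): index zero is y, index (suc i) is x_i.
Var : ℕ → Set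
Var n = Fin (suc n)

Y : ∀ {n} → Poly (Var n)
Y = var zero

X : ∀ {n} → Fin n → Poly (Var n)
X i = var (suc i)

one : ∀ {V} → Poly V
one = con (+ 1)

ismaxPoly₂ : ∀ n → Poly (Var n)
ismaxPoly₂ n = Y ⊕ ∏ n (λ i → one ⊕ X i)

ismaxPoly₃ : ∀ n → Poly (Var n)
ismaxPoly₃ n =
  ⊝ (Y ⊗ Y)
  ⊕ Y ⊗ ( ∏ n (λ i → (one ⊕ X i) ⊗ (one ⊕ X i))
        ⊕ ∏ n (λ i → one ⊕ ⊝ (X i ⊗ X i))
        ⊕ one )
  ⊕ ∏ n (λ i → one ⊕ ⊝ (X i ⊗ X i))

env : ∀ {p n} → Fin p → (Fin n → Fin p) → Var n → ℤ
env y x zero    = + toℕ y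
env y x (suc i) = + toℕ (x i)

IsMinimalExprOfIsmax : (p m : ℕ) → Poly (Var (suc m)) → Set
IsMinimalExprOfIsmax p m P =
  ((v : Var (suc m)) → degIn v P ≤ p ℕ.∸ 1)  ×
  ((y : Fin p) (x : Fin (suc m) → Fin p) →
     eval (env y x) P ≡[mod p ] ismax m y x)

-- Modulo p every factor of the products evaluates to an indicator [x_i ≤ t]:
-- 1 + x ≡ [x ≤ 0] (mod 2), (1 + x)² ≡ [x ≤ 1] and 1 − x² ≡ [x ≤ 0] (mod 3).
-- As [a ≤ t]·[b ≤ t] = [a ⊔ b ≤ t], each product is [max x ≤ t], so the expression depends on x
-- only through M = max x, and a table over (y, M) ∈ 𝔽_p² identifies it with [y = M].
-- Each x_i occurs in one factor of each product only, which gives degree p − 1 in every variable.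
module Submission where

open import Defs
open import Data.Nat using (ℕ; suc)
open import Data.Product using (_×_; _,_)

open import Data.Nat as ℕ using (zero; _⊔_; _<_)
open import Data.Nat.Properties using (⊔-lub; +-identityʳ; ≤-reflexive)
open import Data.Fin using (Fin; zero; suc; toℕ; fromℕ<)
open import Data.Fin.Properties using (toℕ<n; toℕ-fromℕ<; suc-injective) renaming (_≟_ to _≟ᶠ_)
open import Function using (_∘_)
open import Data.Integer as ℤ using (ℤ; +_; _+_; _*_; -_; _-_)
open import Data.Integer.Properties using (*-identityˡ; *-identityʳ; +-inverseʳ)
open import Data.Integer.Divisibility.Signed
  using (divides; ∣⇒∣ᵤ; ∣m∣n⇒∣m+n; ∣n⇒∣m*n; ∣m⇒∣m*n)
  renaming (_∣_ to _∣ˢ_)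
open import Data.Integer.Tactic.RingSolver using (solve-∀)
open import Relation.Binary.PropositionalEquality using (_≡_; _≢_; refl; sym; cong; subst)
open import Data.Empty using (⊥-elim)
open import Relation.Nullary using (yes; no)

-- Unlike `_≡[mod_]_`, which unfolds to divisibility of ∣ a - b ∣, this record keeps a, b and p
-- visible to unification.
record _≈_[mod_] (a b : ℤ) (p : ℕ) : Set where
  constructor ≈mod
  field p∣a-b : + p ∣ˢ (a - b)

infix 4 _≈_[mod_]

module _ {p : ℕ} where

  ≈mod-refl : ∀ {a} → a ≈ a [mod p ]
  ≈mod-refl {a} = ≈mod (divides (+ 0) (+-inverseʳ a))

  ≈mod-trans : ∀ {a b c} → a ≈ b [mod p ] → b ≈ c [mod p ] → a ≈ c [mod p ]
  ≈mod-trans {a} {b} {c} (≈mod a∼b) (≈mod b∼c) =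
    ≈mod (subst (+ p ∣ˢ_) (telescope a b c) (∣m∣n⇒∣m+n a∼b b∼c))
    where
    telescope : ∀ a b c → (a - b) + (b - c) ≡ a - c
    telescope = solve-∀

  +-cong-≈mod : ∀ {a a′ b b′} → a ≈ a′ [mod p ] → b ≈ b′ [mod p ] → a + b ≈ a′ + b′ [mod p ]
  +-cong-≈mod {a} {a′} {b} {b′} (≈mod a∼a′) (≈mod b∼b′) =
    ≈mod (subst (+ p ∣ˢ_) (difference a a′ b b′) (∣m∣n⇒∣m+n a∼a′ b∼b′))
    where
    difference : ∀ a a′ b b′ → (a - a′) + (b - b′) ≡ (a + b) - (a′ + b′)
    difference = solve-∀

  *-cong-≈mod : ∀ {a a′ b b′} → a ≈ a′ [mod p ] → b ≈ b′ [mod p ] → a * b ≈ a′ * b′ [mod p ]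
  *-cong-≈mod {a} {a′} {b} {b′} (≈mod a∼a′) (≈mod b∼b′) =
    ≈mod (subst (+ p ∣ˢ_) (difference a a′ b b′)
      (∣m∣n⇒∣m+n (∣n⇒∣m*n a b∼b′) (∣m⇒∣m*n b′ a∼a′)))
    where
    difference : ∀ a a′ b b′ → a * (b - b′) + (a - a′) * b′ ≡ a * b - a′ * b′
    difference = solve-∀

  ≈mod⇒≡[mod] : ∀ {a b} → a ≈ b [mod p ] → a ≡[mod p ] b
  ≈mod⇒≡[mod] (≈mod p∣a-b) = ∣⇒∣ᵤ p∣a-b

[_≤_] : ℕ → ℕ → ℤ
[ zero  ≤ t     ] = + 1
[ suc a ≤ zero  ] = + 0
[ suc a ≤ suc t ] = [ a ≤ t ]

[≤]*[≤]≡[⊔≤] : ∀ a b t → [ a ≤ t ] * [ b ≤ t ] ≡ [ a ⊔ b ≤ t ]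
[≤]*[≤]≡[⊔≤] zero    b       t       = *-identityˡ [ b ≤ t ]
[≤]*[≤]≡[⊔≤] (suc a) zero    t       = *-identityʳ [ suc a ≤ t ]
[≤]*[≤]≡[⊔≤] (suc a) (suc b) zero    = refl
[≤]*[≤]≡[⊔≤] (suc a) (suc b) (suc t) = [≤]*[≤]≡[⊔≤] a b t

[_≡_] : ℕ → ℕ → ℤ
[ a ≡ b ] with a ℕ.≟ b
... | yes _ = + 1
... | no  _ = + 0

ismax≡[≡] : ∀ {p} m (y : Fin p) x → ismax m y x ≡ [ toℕ y ≡ maxℕ m x ]
ismax≡[≡] m y x with toℕ y ℕ.≟ maxℕ m x
... | yes _ = refl
... | no  _ = refl

maxℕ<p : ∀ {p} m (x : Fin (suc m) → Fin p) → maxℕ m x < p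
maxℕ<p zero    x = toℕ<n (x zero)
maxℕ<p (suc m) x = ⊔-lub (toℕ<n (x zero)) (maxℕ<p m (x ∘ suc))

eval-∏≈[max≤] : ∀ {p V} t (ρ : V → ℤ) m (f : Fin (suc m) → Poly V) (x : Fin (suc m) → Fin p) →
  (∀ i → eval ρ (f i) ≈ [ toℕ (x i) ≤ t ] [mod p ]) →
  eval ρ (∏ (suc m) f) ≈ [ maxℕ m x ≤ t ] [mod p ]
eval-∏≈[max≤] t ρ zero f x f≡ =
  subst (λ b → _ ≈ b [mod _ ]) (*-identityʳ _) (*-cong-≈mod (f≡ zero) ≈mod-refl)
eval-∏≈[max≤] t ρ (suc m) f x f≡ =
  subst (λ b → _ ≈ b [mod _ ]) ([≤]*[≤]≡[⊔≤] (toℕ (x zero)) (maxℕ m (x ∘ suc)) t)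
    (*-cong-≈mod (f≡ zero) (eval-∏≈[max≤] t ρ m (f ∘ suc) (x ∘ suc) (f≡ ∘ suc)))

≈ismax-from-table : ∀ {p} (q : ℕ → ℕ → ℤ) →
  (∀ (y M : Fin p) → q (toℕ y) (toℕ M) ≈ [ toℕ y ≡ toℕ M ] [mod p ]) →
  ∀ m y x → q (toℕ y) (maxℕ m x) ≈ ismax m y x [mod p ]
≈ismax-from-table q table m y x
  rewrite ismax≡[≡] m y x | sym (toℕ-fromℕ< (maxℕ<p m x)) = table y (fromℕ< (maxℕ<p m x))

degIn-var-self : ∀ {k} (v : Fin k) → degIn v (var v) ≡ 1
degIn-var-self v with v ≟ᶠ v
... | yes _   = refl
... | no v≢v = ⊥-elim (v≢v refl)

degIn-var-other : ∀ {k} (v w : Fin k) → v ≢ w → degIn v (var w) ≡ 0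
degIn-var-other v w v≢w with v ≟ᶠ w
... | yes v≡w = ⊥-elim (v≢w v≡w)
... | no  _   = refl

degIn-∏-absent : ∀ {k} (v : Fin k) n (f : Fin n → Poly (Fin k)) →
  (∀ i → degIn v (f i) ≡ 0) → degIn v (∏ n f) ≡ 0
degIn-∏-absent v zero    f f₀ = refl
degIn-∏-absent v (suc n) f f₀ rewrite f₀ zero = degIn-∏-absent v n (f ∘ suc) (f₀ ∘ suc)

degIn-∏-single : ∀ {k} (v : Fin k) n (f : Fin n → Poly (Fin k)) (j : Fin n) →
  (∀ i → i ≢ j → degIn v (f i) ≡ 0) → degIn v (∏ n f) ≡ degIn v (f j)
degIn-∏-single v (suc n) f zero f₀
  rewrite degIn-∏-absent v n (f ∘ suc) (λ i → f₀ (suc i) λ ()) = +-identityʳ (degIn v (f zero))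
degIn-∏-single v (suc n) f (suc j) f₀
  rewrite f₀ zero (λ ()) = degIn-∏-single v n (f ∘ suc) j (λ i i≢j → f₀ (suc i) (i≢j ∘ suc-injective))

onePlus square oneMinusSquare : ∀ {n} → Fin n → Poly (Var n)
onePlus i        = one ⊕ X i
square i         = onePlus i ⊗ onePlus i
oneMinusSquare i = one ⊕ ⊝ (X i ⊗ X i)

degIn-X-other : ∀ {n} (j i : Fin n) → i ≢ j → degIn (suc j) (X i) ≡ 0
degIn-X-other j i i≢j = degIn-var-other (suc j) (suc i) (i≢j ∘ sym ∘ suc-injective)

degIn-y-X : ∀ {n} (i : Fin n) → degIn zero (X i) ≡ 0
degIn-y-X i = degIn-var-other zero (suc i) λ ()

degIn-ismaxPoly₂ : ∀ n (v : Var n) → degIn v (ismaxPoly₂ n) ≡ 1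
degIn-ismaxPoly₂ n zero
  rewrite degIn-∏-absent zero n onePlus degIn-y-X = refl
degIn-ismaxPoly₂ n (suc j)
  rewrite degIn-∏-single (suc j) n onePlus j (degIn-X-other j)
        | degIn-var-self (suc j) = refl

degIn-ismaxPoly₃ : ∀ n (v : Var n) → degIn v (ismaxPoly₃ n) ≡ 2
degIn-ismaxPoly₃ n zero
  rewrite degIn-∏-absent zero n square (λ i → cong (λ d → d ℕ.+ d) (degIn-y-X i))
        | degIn-∏-absent zero n oneMinusSquare (λ i → cong (λ d → d ℕ.+ d) (degIn-y-X i)) = refl
degIn-ismaxPoly₃ n (suc j)
  rewrite degIn-∏-single (suc j) n square j
            (λ i i≢j → cong (λ d → d ℕ.+ d) (degIn-X-other j i i≢j))
        | degIn-∏-single (suc j) n oneMinusSquare j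
            (λ i i≢j → cong (λ d → d ℕ.+ d) (degIn-X-other j i i≢j))
        | degIn-var-self (suc j) = refl

1+x≈[x≤0]-mod2 : ∀ (a : Fin 2) → + 1 + + toℕ a ≈ [ toℕ a ≤ 0 ] [mod 2 ]
1+x≈[x≤0]-mod2 zero       = ≈mod (divides (+ 0) refl)
1+x≈[x≤0]-mod2 (suc zero) = ≈mod (divides (+ 1) refl)

[1+x]²≈[x≤1]-mod3 : ∀ (a : Fin 3) → (+ 1 + + toℕ a) * (+ 1 + + toℕ a) ≈ [ toℕ a ≤ 1 ] [mod 3 ]
[1+x]²≈[x≤1]-mod3 zero             = ≈mod (divides (+ 0) refl)
[1+x]²≈[x≤1]-mod3 (suc zero)       = ≈mod (divides (+ 1) refl)
[1+x]²≈[x≤1]-mod3 (suc (suc zero)) = ≈mod (divides (+ 3) refl)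

1-x²≈[x≤0]-mod3 : ∀ (a : Fin 3) → + 1 + - (+ toℕ a * + toℕ a) ≈ [ toℕ a ≤ 0 ] [mod 3 ]
1-x²≈[x≤0]-mod3 zero             = ≈mod (divides (+ 0) refl)
1-x²≈[x≤0]-mod3 (suc zero)       = ≈mod (divides (+ 0) refl)
1-x²≈[x≤0]-mod3 (suc (suc zero)) = ≈mod (divides (- + 1) refl)

ismaxPoly₂-of-max : ℕ → ℕ → ℤ
ismaxPoly₂-of-max y M = + y + [ M ≤ 0 ]

ismaxPoly₂-of-max-table : ∀ (y M : Fin 2) → ismaxPoly₂-of-max (toℕ y) (toℕ M) ≈ [ toℕ y ≡ toℕ M ] [mod 2 ]
ismaxPoly₂-of-max-table zero       zero       = ≈mod (divides (+ 0) refl)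
ismaxPoly₂-of-max-table zero       (suc zero) = ≈mod (divides (+ 0) refl)
ismaxPoly₂-of-max-table (suc zero) zero       = ≈mod (divides (+ 1) refl)
ismaxPoly₂-of-max-table (suc zero) (suc zero) = ≈mod (divides (+ 0) refl)

ismaxPoly₃-of-max : ℕ → ℕ → ℤ
ismaxPoly₃-of-max y M = - (+ y * + y) + + y * (([ M ≤ 1 ] + [ M ≤ 0 ]) + + 1) + [ M ≤ 0 ]

ismaxPoly₃-of-max-table : ∀ (y M : Fin 3) → ismaxPoly₃-of-max (toℕ y) (toℕ M) ≈ [ toℕ y ≡ toℕ M ] [mod 3 ]
ismaxPoly₃-of-max-table zero             zero             = ≈mod (divides (+ 0) refl)
ismaxPoly₃-of-max-table zero             (suc zero)       = ≈mod (divides (+ 0) refl)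
ismaxPoly₃-of-max-table zero             (suc (suc zero)) = ≈mod (divides (+ 0) refl)
ismaxPoly₃-of-max-table (suc zero)       zero             = ≈mod (divides (+ 1) refl)
ismaxPoly₃-of-max-table (suc zero)       (suc zero)       = ≈mod (divides (+ 0) refl)
ismaxPoly₃-of-max-table (suc zero)       (suc (suc zero)) = ≈mod (divides (+ 0) refl)
ismaxPoly₃-of-max-table (suc (suc zero)) zero             = ≈mod (divides (+ 1) refl)
ismaxPoly₃-of-max-table (suc (suc zero)) (suc zero)       = ≈mod (divides (+ 0) refl)
ismaxPoly₃-of-max-table (suc (suc zero)) (suc (suc zero)) = ≈mod (divides (- + 1) refl)

eval-ismaxPoly₂≈ismax : ∀ m (y : Fin 2) x → eval (env y x) (ismaxPoly₂ (suc m)) ≈ ismax m y x [mod 2 ]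
eval-ismaxPoly₂≈ismax m y x = ≈mod-trans
  (+-cong-≈mod (≈mod-refl {a = + toℕ y}) (eval-∏≈[max≤] 0 (env y x) m onePlus x (1+x≈[x≤0]-mod2 ∘ x)))
  (≈ismax-from-table ismaxPoly₂-of-max ismaxPoly₂-of-max-table m y x)

eval-ismaxPoly₃≈ismax : ∀ m (y : Fin 3) x → eval (env y x) (ismaxPoly₃ (suc m)) ≈ ismax m y x [mod 3 ]
eval-ismaxPoly₃≈ismax m y x = ≈mod-trans
  (+-cong-≈mod (+-cong-≈mod (≈mod-refl {a = - (y′ * y′)}) (*-cong-≈mod (≈mod-refl {a = y′})
    (+-cong-≈mod (+-cong-≈mod ∏square ∏oneMinusSquare) (≈mod-refl {a = + 1})))) ∏oneMinusSquare)
  (≈ismax-from-table ismaxPoly₃-of-max ismaxPoly₃-of-max-table m y x)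
  where
  y′ : ℤ
  y′ = + toℕ y
  ∏square : eval (env y x) (∏ (suc m) square) ≈ [ maxℕ m x ≤ 1 ] [mod 3 ]
  ∏square = eval-∏≈[max≤] 1 (env y x) m square x ([1+x]²≈[x≤1]-mod3 ∘ x)
  ∏oneMinusSquare : eval (env y x) (∏ (suc m) oneMinusSquare) ≈ [ maxℕ m x ≤ 0 ] [mod 3 ]
  ∏oneMinusSquare = eval-∏≈[max≤] 0 (env y x) m oneMinusSquare x (1-x²≈[x≤0]-mod3 ∘ x)

proposition6p2 : (m : ℕ) →
    IsMinimalExprOfIsmax 2 m (ismaxPoly₂ (suc m)) × IsMinimalExprOfIsmax 3 m (ismaxPoly₃ (suc m))
proposition6p2 m =
  ( (λ v → ≤-reflexive (degIn-ismaxPoly₂ (suc m) v))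
  , (λ y x → ≈mod⇒≡[mod] (eval-ismaxPoly₂≈ismax m y x)) )
  ,
  ( (λ v → ≤-reflexive (degIn-ismaxPoly₃ (suc m) v))
  , (λ y x → ≈mod⇒≡[mod] (eval-ismaxPoly₃≈ismax m y x)) )
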